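{- Let $(B_+,\mathcal C_+)$, $(B_-,\mathcal C_-)$ be frame presentations, $L_\pm$ the frame of $\mathcal C_\pm$-ideals, and $\llbracket\cdot\rrbracket_\pm\colon B_\pm\to L_\pm$ the map sending $b$ to the smallest $\mathcal C_\pm$-ideal containing $b$. Let $\mathsf{con}\subseteq L_+\times L_-$ be a relation which is $\sqsubseteq$-downward closed, contains $(1,0)$ and $(0,1)$, is closed under logical meets and joins, and is closed under coordinatewise joins of $\sqsubseteq$-directed subsets. Let $\{b^i_+\}_{i\in I_+}\subseteq\llbracket B_+\rrbracket_+$ and $\{b^i_-\}_{i\in I_- }\subseteq\llbracket B_-\rrbracket_-$. Then $(\bigvee_{i\in I_+}b^i_+,\bigvee_{i\in I_- }b^i_-)\in\mathsf{con}$ if and only if $(b^i_+,b^{i'}_-)\in\mathsf{con}$ for all $(i,i')\in I_+\times I_-$.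
   Context: A frame presentation $(B,\mathcal C)$: $B$ a meet-semilattice with top, $\mathcal C$ a set of pairs $U\dashv a$ ($a\in B$, $U\subseteq\downarrow a$) with $U\dashv a\in\mathcal C$, $b\le a\Rightarrow\{u\wedge b:u\in U\}\dashv b\in\mathcal C$. A $\mathcal C$-ideal is a downset $I\subseteq B$ with $U\dashv a\in\mathcal C,U\subseteq I\Rightarrow a\in I$; these form a frame under inclusion. On $L_+\times L_-$: $\alpha\sqsubseteq\beta$ iff $\alpha_+\le\beta_+$ and $\alpha_-\le\beta_-$; logical join $\alpha\vee\beta=(\alpha_+\vee\beta_+,\alpha_-\wedge\beta_-)$, logical meet $\alpha\wedge\beta=(\alpha_+\wedge\beta_+,\alpha_-\vee\beta_-)$. -}

module Defs where

open import Level using (Level; suc; _⊔_; Lift; lift)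
open import Data.Product using (Σ; ∃; _×_; _,_)
open import Data.Sum using (_⊎_)
open import Data.Empty using (⊥)
open import Data.Unit using () renaming (⊤ to Unit; tt to unit)
open import Relation.Binary.Lattice.Bundles using (BoundedMeetSemilattice)

-- A frame presentation (B, 𝒞), rendered predicatively (as for inductively
-- generated formal topologies): 𝒞 is given as a family of pairs  U ⊣ x
-- indexed by  Ax x : Set a  (the covers of x in 𝒞), where the subset U of
-- the cover  i : Ax x  is the family  elt i : Dom i → Carrier.
record FramePresentation (a : Level) : Set (suc a) where
  field
    B : BoundedMeetSemilattice a a a
  open BoundedMeetSemilattice B public
  field
    Ax        : Carrier → Set a
    Dom       : ∀ {x} → Ax x → Set a
    elt       : ∀ {x} (i : Ax x) → Dom i → Carrier
    elt-below : ∀ {x} (i : Ax x) (d : Dom i) → elt i d ≤ x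
    -- stability: U ⊣ x ∈ 𝒞, y ≤ x  ⇒  {u ∧ y : u ∈ U} ⊣ y ∈ 𝒞
    -- (the new cover j of y has exactly the subset {u ∧ y : u ∈ U}, up to ≈)
    stable    : ∀ {x y} (i : Ax x) → y ≤ x →
                Σ (Ax y) (λ j → (∀ e → Σ (Dom i) (λ d → elt j e ≈ elt i d ∧ y))
                              × (∀ d → Σ (Dom j) (λ e → elt j e ≈ elt i d ∧ y)))

module _ {a : Level} (P : FramePresentation a) where
  open FramePresentation P

  record IsIdeal (I : Carrier → Set a) : Set a where
    field
      ideal-down   : ∀ {x y} → y ≤ x → I x → I y
      ideal-closed : ∀ {x} (i : Ax x) → (∀ d → I (elt i d)) → I x

  Ideal : Set (suc a)
  Ideal = Σ (Carrier → Set a) IsIdeal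

  data Gen (S : Carrier → Set a) : Carrier → Set a where
    gen   : ∀ {x} → S x → Gen S x
    gdown : ∀ {x y} → y ≤ x → Gen S x → Gen S y
    gcov  : ∀ {x} (i : Ax x) → (∀ d → Gen S (elt i d)) → Gen S x

  genIdeal : (Carrier → Set a) → Ideal
  genIdeal S = Gen S , record { ideal-down = gdown ; ideal-closed = gcov }

  ⟦_⟧ : Carrier → Ideal
  ⟦ b ⟧ = genIdeal (λ x → x ≈ b)

  1L : Ideal
  1L = (λ _ → Lift a Unit) , record { ideal-down = λ _ p → p ; ideal-closed = λ _ _ → lift unit }

  0L : Ideal
  0L = genIdeal (λ _ → Lift a ⊥)

  _∧L_ : Ideal → Ideal → Ideal
  (I , iI) ∧L (J , iJ) =
    (λ x → I x × J x) ,
    record { ideal-down = λ { y≤x (p , q) → IsIdeal.ideal-down iI y≤x p , IsIdeal.ideal-down iJ y≤x q }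
           ; ideal-closed = λ c h → IsIdeal.ideal-closed iI c (λ d → Data.Product.proj₁ (h d))
                                  , IsIdeal.ideal-closed iJ c (λ d → Data.Product.proj₂ (h d)) }

  _∨L_ : Ideal → Ideal → Ideal
  (I , _) ∨L (J , _) = genIdeal (λ x → I x ⊎ J x)

  ⋁L : {J : Set a} → (J → Ideal) → Ideal
  ⋁L {J} f = genIdeal (λ x → Σ J (λ j → Data.Product.proj₁ (f j) x))

  _⊆L_ : Ideal → Ideal → Set a
  (I , _) ⊆L (J , _) = ∀ x → I x → J x

record IsCon {a c : Level} (P N : FramePresentation a)
             (con : Ideal P → Ideal N → Set c) : Set (suc a ⊔ c) where
  field
    con-down   : ∀ {α₊ β₊ α₋ β₋} → _⊆L_ P α₊ β₊ → _⊆L_ N α₋ β₋ → con β₊ β₋ → con α₊ α₋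
    con-10     : con (1L P) (0L N)
    con-01     : con (0L P) (1L N)
    con-meet   : ∀ {α₊ β₊ α₋ β₋} → con α₊ α₋ → con β₊ β₋ →
                 con (_∧L_ P α₊ β₊) (_∨L_ N α₋ β₋)
    con-join   : ∀ {α₊ β₊ α₋ β₋} → con α₊ α₋ → con β₊ β₋ →
                 con (_∨L_ P α₊ β₊) (_∧L_ N α₋ β₋)
    con-dir    : ∀ {J : Set a} (f₊ : J → Ideal P) (f₋ : J → Ideal N) →
                 J →
                 (∀ i j → Σ J (λ k → (_⊆L_ P (f₊ i) (f₊ k) × _⊆L_ N (f₋ i) (f₋ k))
                                   × (_⊆L_ P (f₊ j) (f₊ k) × _⊆L_ N (f₋ j) (f₋ k)))) →
                 (∀ j → con (f₊ j) (f₋ j)) →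
                 con (⋁L P f₊) (⋁L N f₋)

module Submission where

open import Defs
open import Level using (Level; lift)
open import Function.Bundles using (_⇔_; mk⇔)
open import Data.Product using (_×_; _,_; proj₁; proj₂)
open import Data.Sum using (inj₁; inj₂)
open import Data.List using (List; []; _∷_; _++_; [_])

-- The statement holds for arbitrary families of ideals. Pairs of finite joins
-- form a ⊑-directed family with the same join as the two families; each such
-- pair lies in con since con is closed under logical meets and joins, with
-- (1,0) and (0,1) covering the empty joins.

module IdealLattice {a : Level} (P : FramePresentation a) where

  -- Ideal arguments are explicit: _⊆L_ sees only their carriers, so they are not inferable.
  private
    _⊆_ : Ideal P → Ideal P → Set a
    _⊆_ = _⊆L_ P

  ⊆-refl : ∀ α → α ⊆ α
  ⊆-refl _ _ p = p

  Gen-least : ∀ {S} (γ : Ideal P) → (∀ x → S x → proj₁ γ x) → genIdeal P S ⊆ γ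
  Gen-least γ S⊆γ x (gen s)       = S⊆γ x s
  Gen-least γ S⊆γ x (gdown y≤x g) = IsIdeal.ideal-down (proj₂ γ) y≤x (Gen-least γ S⊆γ _ g)
  Gen-least γ S⊆γ x (gcov i g)    = IsIdeal.ideal-closed (proj₂ γ) i (λ d → Gen-least γ S⊆γ _ (g d))

  0L-least : ∀ γ → 0L P ⊆ γ
  0L-least γ = Gen-least γ (λ _ ())

  1L-greatest : ∀ α → α ⊆ 1L P
  1L-greatest _ _ _ = lift _

  ∧L-diagonal : ∀ α → α ⊆ _∧L_ P α α
  ∧L-diagonal _ _ p = p , p

  ∨L-upperˡ : ∀ α β → α ⊆ _∨L_ P α β
  ∨L-upperˡ _ _ _ p = gen (inj₁ p)

  ∨L-upperʳ : ∀ α β → β ⊆ _∨L_ P α β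
  ∨L-upperʳ _ _ _ p = gen (inj₂ p)

  ∨L-least : ∀ α β γ → α ⊆ γ → β ⊆ γ → _∨L_ P α β ⊆ γ
  ∨L-least _ _ γ α⊆γ β⊆γ = Gen-least γ (λ { x (inj₁ p) → α⊆γ x p ; x (inj₂ q) → β⊆γ x q })

  ⋁L-upper : ∀ {J} (f : J → Ideal P) j → f j ⊆ ⋁L P f
  ⋁L-upper f j _ p = gen (j , p)

  ⋁L-least : ∀ {J} (f : J → Ideal P) γ → (∀ j → f j ⊆ γ) → ⋁L P f ⊆ γ
  ⋁L-least _ γ f⊆γ = Gen-least γ (λ { x (j , p) → f⊆γ j x p })

  ⋁L-dominated : ∀ {J K} (f : J → Ideal P) (g : K → Ideal P) (e : J → K) →
                 (∀ j → f j ⊆ g (e j)) → ⋁L P f ⊆ ⋁L P g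
  ⋁L-dominated f g e f⊆g = ⋁L-least f (⋁L P g) (λ j x p → ⋁L-upper g (e j) x (f⊆g j x p))

  ⋁fin : ∀ {J : Set a} → (J → Ideal P) → List J → Ideal P
  ⋁fin f []       = 0L P
  ⋁fin f (j ∷ js) = _∨L_ P (f j) (⋁fin f js)

  module _ {J : Set a} (f : J → Ideal P) where

    ⋁fin-++ˡ : ∀ js ks → ⋁fin f js ⊆ ⋁fin f (js ++ ks)
    ⋁fin-++ˡ []       ks = 0L-least (⋁fin f ks)
    ⋁fin-++ˡ (j ∷ js) ks =
      ∨L-least (f j) (⋁fin f js) (⋁fin f (j ∷ js ++ ks)) (∨L-upperˡ (f j) (⋁fin f (js ++ ks)))
        (λ x p → ∨L-upperʳ (f j) (⋁fin f (js ++ ks)) x (⋁fin-++ˡ js ks x p))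

    ⋁fin-++ʳ : ∀ js ks → ⋁fin f ks ⊆ ⋁fin f (js ++ ks)
    ⋁fin-++ʳ []       ks = ⊆-refl (⋁fin f ks)
    ⋁fin-++ʳ (j ∷ js) ks =
      λ x p → ∨L-upperʳ (f j) (⋁fin f (js ++ ks)) x (⋁fin-++ʳ js ks x p)

    ⋁fin-singleton : ∀ j → f j ⊆ ⋁fin f [ j ]
    ⋁fin-singleton j = ∨L-upperˡ (f j) (0L P)

module ConsistencyClosure {a c : Level} {P N : FramePresentation a}
                          {con : Ideal P → Ideal N → Set c} (isCon : IsCon P N con) where

  open IsCon isCon
  module L₊ = IdealLattice P
  module L₋ = IdealLattice N
  open L₊ using (⋁fin)
  open L₋ using () renaming (⋁fin to ⋁fin₋)

  con-0ˡ : ∀ {α₋} → con (0L P) α₋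
  con-0ˡ {α₋} = con-down (L₊.⊆-refl (0L P)) (L₋.1L-greatest α₋) con-01

  con-0ʳ : ∀ {α₊} → con α₊ (0L N)
  con-0ʳ {α₊} = con-down (L₊.1L-greatest α₊) (L₋.⊆-refl (0L N)) con-10

  con-∨ʳ : ∀ {α₊ α₋ β₋} → con α₊ α₋ → con α₊ β₋ → con α₊ (_∨L_ N α₋ β₋)
  con-∨ʳ {α₊} {α₋} {β₋} p q =
    con-down (L₊.∧L-diagonal α₊) (L₋.⊆-refl (_∨L_ N α₋ β₋)) (con-meet p q)

  con-∨ˡ : ∀ {α₊ β₊ α₋} → con α₊ α₋ → con β₊ α₋ → con (_∨L_ P α₊ β₊) α₋
  con-∨ˡ {α₊} {β₊} {α₋} p q =
    con-down (L₊.⊆-refl (_∨L_ P α₊ β₊)) (L₋.∧L-diagonal α₋) (con-join p q)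

  module _ {I₊ I₋ : Set a} {f₊ : I₊ → Ideal P} {f₋ : I₋ → Ideal N}
           (pairwise : ∀ i i′ → con (f₊ i) (f₋ i′)) where

    con-⋁finʳ : ∀ i is′ → con (f₊ i) (⋁fin₋ f₋ is′)
    con-⋁finʳ i []         = con-0ʳ
    con-⋁finʳ i (i′ ∷ is′) = con-∨ʳ (pairwise i i′) (con-⋁finʳ i is′)

    con-⋁fin : ∀ is is′ → con (⋁fin f₊ is) (⋁fin₋ f₋ is′)
    con-⋁fin []       is′ = con-0ˡ
    con-⋁fin (i ∷ is) is′ = con-∨ˡ (con-⋁finʳ i is′) (con-⋁fin is is′)

    -- Index the directed family by pairs of lists; concatenation is an upper bound.
    con-⋁ : con (⋁L P f₊) (⋁L N f₋)
    con-⋁ = con-down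
      (L₊.⋁L-dominated f₊ finite₊ (λ i → [ i ] , []) (L₊.⋁fin-singleton f₊))
      (L₋.⋁L-dominated f₋ finite₋ (λ i′ → [] , [ i′ ]) (L₋.⋁fin-singleton f₋))
      (con-dir finite₊ finite₋ ([] , [])
        (λ { (is , is′) (ks , ks′) → (is ++ ks , is′ ++ ks′)
             , (L₊.⋁fin-++ˡ f₊ is ks , L₋.⋁fin-++ˡ f₋ is′ ks′)
             , (L₊.⋁fin-++ʳ f₊ is ks , L₋.⋁fin-++ʳ f₋ is′ ks′) })
        (λ { (is , is′) → con-⋁fin is is′ }))
      where
      finite₊ : List I₊ × List I₋ → Ideal P
      finite₊ (is , _) = ⋁fin f₊ is
      finite₋ : List I₊ × List I₋ → Ideal N
      finite₋ (_ , is′) = ⋁fin₋ f₋ is′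

  con-⋁⇔pairwise : ∀ {I₊ I₋ : Set a} (f₊ : I₊ → Ideal P) (f₋ : I₋ → Ideal N) →
                   con (⋁L P f₊) (⋁L N f₋) ⇔ (∀ i i′ → con (f₊ i) (f₋ i′))
  con-⋁⇔pairwise f₊ f₋ = mk⇔
    (λ h i i′ → con-down (L₊.⋁L-upper f₊ i) (L₋.⋁L-upper f₋ i′) h)
    con-⋁

lemma2 : {a c : Level} (P N : FramePresentation a)
         (con : Ideal P → Ideal N → Set c) → IsCon P N con →
         (I₊ I₋ : Set a)
         (b₊ : I₊ → FramePresentation.Carrier P)
         (b₋ : I₋ → FramePresentation.Carrier N) →
         con (⋁L P (λ i → ⟦_⟧ P (b₊ i))) (⋁L N (λ i → ⟦_⟧ N (b₋ i)))
           ⇔ (∀ i i′ → con (⟦_⟧ P (b₊ i)) (⟦_⟧ N (b₋ i′)))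
lemma2 P N con isCon I₊ I₋ b₊ b₋ =
  ConsistencyClosure.con-⋁⇔pairwise isCon (λ i → ⟦_⟧ P (b₊ i)) (λ i → ⟦_⟧ N (b₋ i))
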